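{- If $G$ is a connected graph of order at least $3$ and $i\ge 3$, then $3\le \chi_{\rho}(S_i(G))\le 4$.
   Context: For a graph $G$ and $i\ge1$, $S_i(G)$ is the graph obtained from $G$ by replacing each edge with a path of length $i+1$ (subdividing each edge exactly $i$ times). For a positive integer $j$, a $j$-packing in a graph $H$ is a set of vertices any two distinct of which are at distance greater than $j$ in $H$. The packing chromatic number $\chi_{\rho}(H)$ is the smallest $k$ such that $V(H)$ can be partitioned into sets $\Pi_1,\ldots,\Pi_k$ with $\Pi_j$ a $j$-packing for each $j\in[k]$. -}

module Defs where

open import Data.Nat using (ℕ; zero; suc; _≤_; _<_)
open import Data.Fin using (Fin; toℕ)
open import Data.Bool using (Bool; true; false; T)
open import Data.Sum using (_⊎_; inj₁; inj₂)
open import Data.Product using (Σ; _×_; _,_; ∃)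
open import Relation.Binary.PropositionalEquality using (_≡_; _≢_)
open import Relation.Nullary using (¬_)

record SimpleGraph (n : ℕ) : Set where
  field
    adj    : Fin n → Fin n → Bool
    sym    : ∀ u v → adj u v ≡ adj v u
    irrefl : ∀ u → adj u u ≡ false
open SimpleGraph public

data Walk {V : Set} (Adj : V → V → Set) : V → V → ℕ → Set where
  here : ∀ {x} → Walk Adj x x zero
  step : ∀ {x y z k} → Adj x y → Walk Adj y z k → Walk Adj x z (suc k)

Connected : {V : Set} → (V → V → Set) → Set
Connected {V} Adj = ∀ (x y : V) → ∃ λ k → Walk Adj x y k

GAdj : ∀ {n} → SimpleGraph n → Fin n → Fin n → Set
GAdj G u v = T (adj G u v)

record Edge {n : ℕ} (G : SimpleGraph n) : Set where
  constructor edge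
  field
    a  : Fin n
    b  : Fin n
    lt : toℕ a < toℕ b
    ok : T (adj G a b)

-- Vertices of S_i(G): original vertices, plus i internal vertices on each edge.
-- Internal vertex (e , k) is the (k+1)-th vertex on the path from a to b.
SubV : ∀ {n} → SimpleGraph n → ℕ → Set
SubV {n} G i = Fin n ⊎ (Edge G × Fin i)

data SubStep {n : ℕ} (G : SimpleGraph n) (i : ℕ) : SubV G i → SubV G i → Set where
  start : ∀ (e : Edge G) (k : Fin i) → toℕ k ≡ 0 →
          SubStep G i (inj₁ (Edge.a e)) (inj₂ (e , k))
  mid   : ∀ (e : Edge G) (k k' : Fin i) → toℕ k' ≡ suc (toℕ k) →
          SubStep G i (inj₂ (e , k)) (inj₂ (e , k'))
  end   : ∀ (e : Edge G) (k : Fin i) → suc (toℕ k) ≡ i →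
          SubStep G i (inj₂ (e , k)) (inj₁ (Edge.b e))

SubAdj : ∀ {n} (G : SimpleGraph n) (i : ℕ) → SubV G i → SubV G i → Set
SubAdj G i x y = SubStep G i x y ⊎ SubStep G i y x

DistGreater : {V : Set} → (V → V → Set) → V → V → ℕ → Set
DistGreater Adj x y j = ∀ m → Walk Adj x y m → j < m

-- A packing k-colouring: c x ∈ {1..k}, colour class Π_j = c⁻¹(j) is a j-packing.
-- (Equivalent to a partition of V into Π_1,…,Π_k with Π_j a j-packing.)
PackingColouring : {V : Set} → (V → V → Set) → ℕ → Set
PackingColouring {V} Adj k =
  Σ (V → ℕ) λ c →
    (∀ x → 1 ≤ c x × c x ≤ k) ×
    (∀ x y → x ≢ y → c x ≡ c y → DistGreater Adj x y (c x))

IsPackingChromaticNumber : {V : Set} → (V → V → Set) → ℕ → Set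
IsPackingChromaticNumber Adj k =
  PackingColouring Adj k × (∀ m → m < k → ¬ PackingColouring Adj m)

-- Lower bound: an edge subdivided at least three times contains a path on four vertices, which
-- has no packing colouring with colours 1 and 2.
-- Upper bound: colour the original vertices and the internal vertices of every subdivided edge
-- by one word c₀ … c_L over {1,2,3,4}, L = i + 1, that packs the path on L + 1 vertices, has
-- c_L = c₀, and has ⌊c_p/2⌋ below both p and L − p at internal positions p. Distances in S_i(G)
-- are bounded below by 1-Lipschitz functions, and a walk between vertices of colour c on two
-- different subdivided edges passes an end of the first one, so has length at least
-- 2(⌊c/2⌋ + 1) > c. Such words exist for every L ≥ 4: seven short ones, and prefixing 2131 to
-- a word beginning with 2131 passes from L to L + 4. Finally S_i(G) is finite, so whether three
-- colours suffice is decidable, and χ_ρ is 3 or 4 accordingly.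

module Submission where

open import Data.Bool using (T; true; _∨_; not)
open import Data.Bool.Properties using (T?; T-irrelevant)
open import Data.Empty using (⊥; ⊥-elim)
open import Data.Fin using (Fin; toℕ; fromℕ<; zero; suc)
open import Data.Fin.Properties using (toℕ<n; toℕ-fromℕ<; toℕ-injective) renaming (_≟_ to _≟ᶠ_)
import Data.Fin.Properties as Fin
open import Data.List using (List; []; _∷_; length; lookup; map; _++_; concatMap; cartesianProduct; allFin)
open import Data.List.Membership.Propositional using (_∈_; lose)
open import Data.List.Membership.Propositional.Properties
  using (∈-map⁺; ∈-++⁺ˡ; ∈-++⁺ʳ; ∈-concatMap⁺; ∈-cartesianProduct⁺; ∈-allFin)
import Data.List.Relation.Unary.All as All
open import Data.List.Relation.Unary.Any as Any using (here)
open import Data.List.Relation.Unary.Any.Properties using (lookup-index)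
open import Data.Nat
  using (ℕ; zero; suc; pred; _+_; _∸_; _≤_; _<_; z≤n; s≤s; _≤ᵇ_; _<ᵇ_; _≡ᵇ_; ⌊_/2⌋; ⌈_/2⌉; ∣_-_∣)
open import Data.Nat.Properties
open import Data.Product using (∃; _×_; _,_; proj₁; proj₂; uncurry)
import Data.Product.Properties as Product
open import Data.Sum using (_⊎_; inj₁; inj₂; [_,_]′)
import Data.Sum.Properties as Sum
open import Data.Unit using (⊤)
open import Data.Vec using (Vec; []; _∷_; tabulate)
import Data.Vec as Vec
open import Data.Vec.Properties using (lookup∘tabulate)
open import Function using (_∘_)
open import Relation.Binary.Definitions using (Decidable; DecidableEquality; tri<; tri≈; tri>)
open import Relation.Binary.PropositionalEquality
  using (_≡_; _≢_; refl; sym; trans; cong; cong₂; subst; subst₂; module ≡-Reasoning)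
open import Relation.Nullary using (¬_; Dec; yes; no; ¬?)
open import Relation.Nullary.Decidable using (_×-dec_; _⊎-dec_; _→-dec_; map′)

open import Defs hiding (sym)

⌊n/2⌋<m⇒⌊n/2⌋<o⇒n<m+o : ∀ {n m o} → ⌊ n /2⌋ < m → ⌊ n /2⌋ < o → n < m + o
⌊n/2⌋<m⇒⌊n/2⌋<o⇒n<m+o {n} {m} {o} h<m h<o = begin-strict
  n                               ≡⟨ ⌊n/2⌋+⌈n/2⌉≡n n ⟨
  ⌊ n /2⌋ + ⌈ n /2⌉               ≤⟨ +-monoʳ-≤ ⌊ n /2⌋ (⌊n/2⌋-mono (n≤1+n (suc n))) ⟩
  ⌊ n /2⌋ + suc ⌊ n /2⌋           <⟨ +-monoˡ-< (suc ⌊ n /2⌋) (n<1+n ⌊ n /2⌋) ⟩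
  suc ⌊ n /2⌋ + suc ⌊ n /2⌋       ≤⟨ +-mono-≤ h<m h<o ⟩
  m + o                           ∎
  where open ≤-Reasoning

n<m+m⇒⌊n/2⌋<m : ∀ {n m} → n < m + m → ⌊ n /2⌋ < m
n<m+m⇒⌊n/2⌋<m {zero}        {suc m} _ = s≤s z≤n
n<m+m⇒⌊n/2⌋<m {suc zero}    {suc m} _ = s≤s z≤n
n<m+m⇒⌊n/2⌋<m {suc (suc n)} {suc m} (s≤s n<m+m) =
  s≤s (n<m+m⇒⌊n/2⌋<m (≤-pred (subst (suc (suc n) ≤_) (+-suc m m) n<m+m)))

∣n-1+n∣≡1 : ∀ n → ∣ n - suc n ∣ ≡ 1
∣n-1+n∣≡1 n = trans (m≤n⇒∣m-n∣≡n∸m (n≤1+n n)) (m+n∸n≡m 1 n)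

n<m⇒m∸n≡1+[m∸[1+n]] : ∀ {m n} → n < m → m ∸ n ≡ suc (m ∸ suc n)
n<m⇒m∸n≡1+[m∸[1+n]] (s≤s n≤m) = +-∸-assoc 1 n≤m

-- Packing colourings of an arbitrary graph

module _ {V : Set} {Adj : V → V → Set} where

  Lipschitz : (V → ℕ) → Set
  Lipschitz φ = ∀ {x y} → Adj x y → ∣ φ x - φ y ∣ ≤ 1

  Lipschitz⇒∣-∣≤length : ∀ {φ} → Lipschitz φ → ∀ {x y m} → Walk Adj x y m → ∣ φ x - φ y ∣ ≤ m
  Lipschitz⇒∣-∣≤length {φ} lip {x} here = ≤-reflexive (∣n-n∣≡0 (φ x))
  Lipschitz⇒∣-∣≤length {φ} lip {x} {y} (step {y = z} x~z w) =
    ≤-trans (∣-∣-triangle (φ x) (φ z) (φ y)) (+-mono-≤ (lip x~z) (Lipschitz⇒∣-∣≤length {φ} lip w))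

  PackingColouring-mono : ∀ {k l} → k ≤ l → PackingColouring Adj k → PackingColouring Adj l
  PackingColouring-mono k≤l (c , range , packing) =
    c , (λ x → proj₁ (range x) , ≤-trans (proj₂ (range x)) k≤l) , packing

  ¬PackingColouring₂-P₄ : ∀ {v₀ v₁ v₂ v₃} → Adj v₀ v₁ → Adj v₁ v₂ → Adj v₂ v₃ →
    v₀ ≢ v₁ → v₁ ≢ v₂ → v₂ ≢ v₃ → v₀ ≢ v₂ → v₁ ≢ v₃ → ¬ PackingColouring Adj 2
  ¬PackingColouring₂-P₄ {v₀} {v₁} {v₂} {v₃} a₀₁ a₁₂ a₂₃ v₀≢v₁ v₁≢v₂ v₂≢v₃ v₀≢v₂ v₁≢v₃
                        (c , range , packing) =
    [ via-v₀v₂ , via-v₁v₃ ]′ (one-or-two v₁)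
    where
    one-or-two : ∀ x → c x ≡ 1 ⊎ c x ≡ 2
    one-or-two x with c x | range x
    ... | 1 | _ = inj₁ refl
    ... | 2 | _ = inj₂ refl
    ... | suc (suc (suc _)) | _ , s≤s (s≤s ())

    ≢1⇒≡2 : ∀ {x} → c x ≢ 1 → c x ≡ 2
    ≢1⇒≡2 {x} c≢1 = [ (λ c≡1 → ⊥-elim (c≢1 c≡1)) , (λ c≡2 → c≡2) ]′ (one-or-two x)

    ≢2⇒≡1 : ∀ {x} → c x ≢ 2 → c x ≡ 1
    ≢2⇒≡1 {x} c≢2 = [ (λ c≡1 → c≡1) , (λ c≡2 → ⊥-elim (c≢2 c≡2)) ]′ (one-or-two x)

    apart₁ : ∀ {x y} → Adj x y → x ≢ y → c x ≢ c y
    apart₁ {x} {y} x~y x≢y cx≡cy = ≤⇒≯ (proj₁ (range x)) (packing x y x≢y cx≡cy 1 (step x~y here))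

    apart₂ : ∀ {x y z} → Adj x y → Adj y z → x ≢ z → c x ≡ 2 → c z ≡ 2 → ⊥
    apart₂ {x} {_} {z} x~y y~z x≢z cx≡2 cz≡2 =
      <-irrefl refl (subst (_< 2) cx≡2 (packing x z x≢z (trans cx≡2 (sym cz≡2)) 2 (step x~y (step y~z here))))

    via-v₀v₂ : c v₁ ≡ 1 → ⊥
    via-v₀v₂ c₁≡1 =
      apart₂ a₀₁ a₁₂ v₀≢v₂ (≢1⇒≡2 (λ c₀≡1 → apart₁ a₀₁ v₀≢v₁ (trans c₀≡1 (sym c₁≡1))))
                           (≢1⇒≡2 (λ c₂≡1 → apart₁ a₁₂ v₁≢v₂ (trans c₁≡1 (sym c₂≡1))))

    via-v₁v₃ : c v₁ ≡ 2 → ⊥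
    via-v₁v₃ c₁≡2 =
      apart₂ a₁₂ a₂₃ v₁≢v₃ c₁≡2 (≢1⇒≡2 (λ c₃≡1 → apart₁ a₂₃ v₂≢v₃ (trans c₂≡1 (sym c₃≡1))))
      where
      c₂≡1 : c v₂ ≡ 1
      c₂≡1 = ≢2⇒≡1 (λ c₂≡2 → apart₁ a₁₂ v₁≢v₂ (trans c₁≡2 (sym c₂≡2)))

  packingChromaticNumber-squeeze : ∀ {k} → ¬ PackingColouring Adj k → PackingColouring Adj (2 + k) →
    Dec (PackingColouring Adj (suc k)) →
    ∃ λ χ → IsPackingChromaticNumber Adj χ × suc k ≤ χ × χ ≤ 2 + k
  packingChromaticNumber-squeeze {k} ¬k k+2 (yes k+1) =
    suc k , (k+1 , λ m m<k+1 → ¬k ∘ PackingColouring-mono (≤-pred m<k+1)) , ≤-refl , n≤1+n (suc k)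
  packingChromaticNumber-squeeze {k} ¬k k+2 (no ¬k+1) =
    2 + k , (k+2 , λ m m<k+2 → ¬k+1 ∘ PackingColouring-mono (≤-pred m<k+2)) , n≤1+n (suc k) , ≤-refl

-- Deciding packing colourability of a finite graph

∃-Vec? : ∀ {k} N {P : Vec (Fin k) N → Set} → (∀ v → Dec (P v)) → Dec (∃ P)
∃-Vec? zero    P? = map′ ([] ,_) (λ { ([] , p) → p }) (P? [])
∃-Vec? (suc N) {P} P? =
  map′ (λ (a , v , p) → a ∷ v , p) (λ { (a ∷ v , p) → a , v , p })
       (Fin.any? λ a → ∃-Vec? N {P ∘ (a ∷_)} (P? ∘ (a ∷_)))

module FiniteGraph {V : Set} (vertices : List V) (complete : ∀ x → x ∈ vertices)
                   (_≟ᵥ_ : DecidableEquality V) {Adj : V → V → Set} (adj? : Decidable Adj) where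

  walk? : ∀ m x y → Dec (Walk Adj x y m)
  walk? zero    x y = map′ (λ { refl → here }) (λ { here → refl }) (x ≟ᵥ y)
  walk? (suc m) x y =
    map′ (first-step ∘ Any.satisfied) (λ { (step {y = z} x~z w) → lose (complete z) (x~z , w) })
         (Any.any? (λ z → adj? x z ×-dec walk? m z y) vertices)
    where
    first-step : (∃ λ z → Adj x z × Walk Adj z y m) → Walk Adj x y (suc m)
    first-step (_ , x~z , w) = step x~z w

  distGreater? : ∀ x y j → Dec (DistGreater Adj x y j)
  distGreater? x y j = map′ far none (Fin.all? λ t → ¬? (walk? (toℕ t) x y))
    where
    far : (∀ (t : Fin (suc j)) → ¬ Walk Adj x y (toℕ t)) → DistGreater Adj x y j
    far no-walk m w with m ≤? j
    ... | yes m≤j =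
      ⊥-elim (no-walk (fromℕ< (s≤s m≤j)) (subst (Walk Adj x y) (sym (toℕ-fromℕ< (s≤s m≤j))) w))
    ... | no m≰j  = ≰⇒> m≰j
    none : DistGreater Adj x y j → ∀ (t : Fin (suc j)) → ¬ Walk Adj x y (toℕ t)
    none far t w = <⇒≱ (far (toℕ t) w) (≤-pred (toℕ<n t))

  IsPacking : (V → ℕ) → Set
  IsPacking c = ∀ x y → x ≢ y → c x ≡ c y → DistGreater Adj x y (c x)

  isPacking? : ∀ c → Dec (IsPacking c)
  isPacking? c =
    map′ (λ all x y → All.lookup (All.lookup all (complete x)) (complete y))
         (λ pk → All.tabulate λ {x} _ → All.tabulate λ {y} _ → pk x y)
         (All.all? (λ x → All.all? (λ y → pair? x y) vertices) vertices)
    where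
    pair? : ∀ x y → Dec (x ≢ y → c x ≡ c y → DistGreater Adj x y (c x))
    pair? x y = ¬? (x ≟ᵥ y) →-dec (c x ≟ c y) →-dec distGreater? x y (c x)

  IsPacking-cong : ∀ {c c′} → (∀ x → c x ≡ c′ x) → IsPacking c → IsPacking c′
  IsPacking-cong c≗c′ pk x y x≢y eq =
    subst (DistGreater Adj x y) (c≗c′ x) (pk x y x≢y (trans (c≗c′ x) (trans eq (sym (c≗c′ y)))))

  -- A colouring with colours 1..k is encoded by a vector of Fin k, indexed by the position of a vertex in the list.
  fromVec : ∀ {k} → Vec (Fin k) (length vertices) → V → ℕ
  fromVec v x = suc (toℕ (Vec.lookup v (Any.index (complete x))))

  colourIndex : ∀ {c k} → 1 ≤ c × c ≤ k → Fin k
  colourIndex {suc c} (_ , c<k) = fromℕ< c<k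

  suc-toℕ-colourIndex : ∀ {c k} (r : 1 ≤ c × c ≤ k) → suc (toℕ (colourIndex r)) ≡ c
  suc-toℕ-colourIndex {suc c} (_ , c<k) = cong suc (toℕ-fromℕ< c<k)

  packingColouring? : ∀ k → Dec (PackingColouring Adj k)
  packingColouring? k = map′ decode encode (∃-Vec? (length vertices) (isPacking? ∘ fromVec {k}))
    where
    decode : ∃ (IsPacking ∘ fromVec) → PackingColouring Adj k
    decode (v , pk) = fromVec v , (λ x → s≤s z≤n , toℕ<n (Vec.lookup v (Any.index (complete x)))) , pk
    encode : PackingColouring Adj k → ∃ (IsPacking ∘ fromVec {k})
    encode (c , range , pk) = v , IsPacking-cong c≗fromVec-v pk
      where
      v : Vec (Fin k) (length vertices)
      v = tabulate (λ j → colourIndex (range (lookup vertices j)))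
      c≗fromVec-v : ∀ x → c x ≡ fromVec v x
      c≗fromVec-v x = sym (begin
        fromVec v x                                           ≡⟨ cong (suc ∘ toℕ) (lookup∘tabulate _ j) ⟩
        suc (toℕ (colourIndex (range (lookup vertices j))))   ≡⟨ suc-toℕ-colourIndex (range (lookup vertices j)) ⟩
        c (lookup vertices j)                                 ≡⟨ cong c (lookup-index (complete x)) ⟨
        c x                                                   ∎)
        where
        open ≡-Reasoning
        j = Any.index (complete x)

-- Colourings of a subdivided edge

record PathColouring (L : ℕ) (c : ℕ → ℕ) : Set where
  field
    colour-range   : ∀ {p} → p ≤ L → 1 ≤ c p × c p ≤ 4
    packing        : ∀ {p q} → p < q → q ≤ L → c p ≡ c q → c p < q ∸ p
    ends-agree     : c L ≡ c 0
    far-from-start : ∀ {p} → 0 < p → p < L → ⌊ c p /2⌋ < p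
    far-from-end   : ∀ {p} → 0 < p → p < L → ⌊ c p /2⌋ < L ∸ p

  packing-∣-∣ : ∀ {p q} → p ≢ q → p ≤ L → q ≤ L → c p ≡ c q → c p < ∣ p - q ∣
  packing-∣-∣ {p} {q} p≢q p≤L q≤L cp≡cq with <-cmp p q
  ... | tri< p<q _ _ = subst (c p <_) (sym (m≤n⇒∣m-n∣≡n∸m (<⇒≤ p<q))) (packing p<q q≤L cp≡cq)
  ... | tri≈ _ p≡q _ = ⊥-elim (p≢q p≡q)
  ... | tri> _ _ q<p =
    subst₂ _<_ (sym cp≡cq) (sym (m≤n⇒∣n-m∣≡n∸m (<⇒≤ q<p))) (packing q<p p≤L (sym cp≡cq))

at : List ℕ → ℕ → ℕ
at []       _       = 0
at (x ∷ _)  zero    = x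
at (_ ∷ xs) (suc p) = at xs p

InRange : List ℕ → Set
InRange []       = ⊤
InRange (x ∷ xs) = T (1 ≤ᵇ x) × T (x ≤ᵇ 4) × InRange xs

-- x stands at distance d before ys; only the first w entries of ys are inspected.
ClearAhead : (x d w : ℕ) → List ℕ → Set
ClearAhead x d zero    _        = ⊤
ClearAhead x d (suc w) []       = ⊤
ClearAhead x d (suc w) (y ∷ ys) = T (not (x ≡ᵇ y) ∨ (x <ᵇ d)) × ClearAhead x (suc d) w ys

-- Colours are at most 4, so a window of 4 entries suffices.
Spaced : List ℕ → Set
Spaced []       = ⊤
Spaced (x ∷ xs) = ClearAhead x 1 4 xs × Spaced xs

EndsWith : ℕ → List ℕ → Set
EndsWith c (z ∷ y ∷ c′ ∷ []) = T (z ≤ᵇ 3) × T (y ≡ᵇ 1) × T (c′ ≡ᵇ c)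
EndsWith c []                = ⊥
EndsWith c (_ ∷ xs)          = EndsWith c xs

-- As ⌊c/2⌋ ≤ 2 for c ≤ 4, the margin conditions of PathColouring bind only the two entries next to each end.
Valid : List ℕ → Set
Valid (c ∷ y ∷ z ∷ rest) =
  T (y ≡ᵇ 1) × T (z ≤ᵇ 3) × EndsWith c (y ∷ z ∷ rest) ×
  InRange (c ∷ y ∷ z ∷ rest) × Spaced (c ∷ y ∷ z ∷ rest)
Valid _ = ⊥

⌊n/2⌋<3 : ∀ {n} → n ≤ 4 → ⌊ n /2⌋ < 3
⌊n/2⌋<3 n≤4 = s≤s (⌊n/2⌋-mono n≤4)

at-InRange : ∀ {l p} → InRange l → p < length l → 1 ≤ at l p × at l p ≤ 4
at-InRange {x ∷ _}  {zero}  (1≤x , x≤4 , _) _       = ≤ᵇ⇒≤ 1 x 1≤x , ≤ᵇ⇒≤ x 4 x≤4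
at-InRange {_ ∷ xs} {suc p} (_ , _ , r)      (s≤s p<) = at-InRange {xs} r p<

head≤4 : ∀ {y ys} → InRange (y ∷ ys) → y ≤ 4
head≤4 {y} (_ , y≤4 , _) = ≤ᵇ⇒≤ y 4 y≤4

same-colour-far : ∀ {x y d} → T (not (x ≡ᵇ y) ∨ (x <ᵇ d)) → x ≡ y → x < d
same-colour-far {x} {_} {d} t refl = <ᵇ⇒< x d (implied (x ≡ᵇ x) t (≡⇒≡ᵇ x x refl))
  where
  implied : ∀ b {b′} → T (not b ∨ b′) → T b → T b′
  implied true t _ = t

ClearAhead-sound : ∀ {x d w ys j} → ClearAhead x d w ys → x ≤ 4 → 5 ≤ d + w →
                   j < length ys → at ys j ≡ x → x < d + j
ClearAhead-sound {x} {d} {zero} {_} {j} _ x≤4 5≤d _ _ =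
  ≤-trans (s≤s x≤4) (≤-trans (subst (5 ≤_) (+-identityʳ d) 5≤d) (m≤m+n d j))
ClearAhead-sound {x} {d} {suc w} {y ∷ ys} {zero} (t , _) _ _ _ y≡x =
  subst (x <_) (sym (+-identityʳ d)) (same-colour-far t (sym y≡x))
ClearAhead-sound {x} {d} {suc w} {y ∷ ys} {suc j} (_ , cl) x≤4 5≤d+w (s≤s j<) ys[j]≡x =
  subst (x <_) (sym (+-suc d j))
    (ClearAhead-sound {ys = ys} cl x≤4 (subst (5 ≤_) (+-suc d w) 5≤d+w) j< ys[j]≡x)

Spaced-sound : ∀ {l p q} → InRange l → Spaced l → p < q → q < length l →
               at l p ≡ at l q → at l p < q ∸ p
Spaced-sound {x ∷ xs} {zero} {suc j} r (cl , _) _ (s≤s j<) x≡ =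
  ClearAhead-sound {ys = xs} cl (head≤4 {x} {xs} r) ≤-refl j< (sym x≡)
Spaced-sound {x ∷ xs} {suc p} {suc q} (_ , _ , r) (_ , sp) (s≤s p<q) (s≤s q<) eq =
  Spaced-sound {xs} r sp p<q q< eq

EndsWith-last : ∀ {c y xs} → EndsWith c xs → at (y ∷ xs) (length xs) ≡ c
EndsWith-last {c} {_} {z ∷ u ∷ c′ ∷ []}    (_ , _ , c′≡c) = ≡ᵇ⇒≡ c′ c c′≡c
EndsWith-last {c} {_} {x ∷ u ∷ v ∷ w ∷ ws} e           = EndsWith-last {c} {x} {u ∷ v ∷ w ∷ ws} e

EndsWith-far : ∀ {c y xs p} → EndsWith c xs → InRange (y ∷ xs) → p < length xs →
               ⌊ at (y ∷ xs) p /2⌋ < length xs ∸ p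
EndsWith-far {y = y} {xs@(_ ∷ _ ∷ _ ∷ [])} {zero} _ r _ = ⌊n/2⌋<3 (head≤4 {y} {xs} r)
EndsWith-far {xs = z ∷ _ ∷ _ ∷ []} {1} (z≤3 , _ , _) _ _ = n<m+m⇒⌊n/2⌋<m (s≤s (≤ᵇ⇒≤ z 3 z≤3))
EndsWith-far {xs = _ ∷ u ∷ _ ∷ []} {2} (_ , u≡1 , _) _ _ =
  n<m+m⇒⌊n/2⌋<m (subst (_< 2) (sym (≡ᵇ⇒≡ u 1 u≡1)) ≤-refl)
EndsWith-far {xs = _ ∷ _ ∷ _ ∷ []} {suc (suc (suc _))} _ _ (s≤s (s≤s (s≤s ())))
EndsWith-far {y = y} {xs@(_ ∷ _ ∷ _ ∷ _ ∷ _)} {zero} _ r _ =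
  <-≤-trans (⌊n/2⌋<3 (head≤4 {y} {xs} r)) (s≤s (s≤s (s≤s z≤n)))
EndsWith-far {xs = x ∷ xs@(_ ∷ _ ∷ _ ∷ _)} {suc p} e (_ , _ , r) (s≤s p<) = EndsWith-far {y = x} {xs} e r p<

Valid⇒PathColouring : ∀ l → Valid l → PathColouring (pred (length l)) (at l)
Valid⇒PathColouring l@(c ∷ y ∷ z ∷ rest) (y≡1 , z≤3 , e , r , sp) = record
  { colour-range   = λ p≤L → at-InRange {l} r (s≤s p≤L)
  ; packing        = λ p<q q≤L → Spaced-sound {l} r sp p<q (s≤s q≤L)
  ; ends-agree     = EndsWith-last {c} {c} {y ∷ z ∷ rest} e
  ; far-from-start = clear-of-start
  ; far-from-end   = λ _ → EndsWith-far {c} {c} {y ∷ z ∷ rest} e r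
  }
  where
  clear-of-start : ∀ {p} → 0 < p → p < length (y ∷ z ∷ rest) → ⌊ at l p /2⌋ < p
  clear-of-start {1} _ _ = n<m+m⇒⌊n/2⌋<m (subst (_< 2) (sym (≡ᵇ⇒≡ y 1 y≡1)) ≤-refl)
  clear-of-start {2} _ _ = n<m+m⇒⌊n/2⌋<m (s≤s (≤ᵇ⇒≤ z 3 z≤3))
  clear-of-start {p@(suc (suc (suc _)))} _ p<L =
    <-≤-trans (⌊n/2⌋<3 (proj₂ (at-InRange {l} r (m≤n⇒m≤1+n p<L)))) (s≤s (s≤s (s≤s z≤n)))

Valid-prepend-2131 : ∀ {rest} → Valid (2 ∷ 1 ∷ 3 ∷ 1 ∷ rest) →
                     Valid (2 ∷ 1 ∷ 3 ∷ 1 ∷ 2 ∷ 1 ∷ 3 ∷ 1 ∷ rest)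
Valid-prepend-2131 (_ , _ , e , r , sp) = _ , _ , e , (_ , _ , _ , _ , _ , _ , _ , _ , r) , (_ , _ , _ , _ , sp)

pathColours : ℕ → List ℕ
pathColours 0 = 2 ∷ 1 ∷ 3 ∷ 1 ∷ 2 ∷ []
pathColours 1 = 4 ∷ 1 ∷ 2 ∷ 3 ∷ 1 ∷ 4 ∷ []
pathColours 2 = 4 ∷ 1 ∷ 2 ∷ 1 ∷ 3 ∷ 1 ∷ 4 ∷ []
pathColours 3 = 4 ∷ 1 ∷ 2 ∷ 1 ∷ 3 ∷ 2 ∷ 1 ∷ 4 ∷ []
pathColours 5 = 2 ∷ 1 ∷ 3 ∷ 1 ∷ 2 ∷ 1 ∷ 4 ∷ 3 ∷ 1 ∷ 2 ∷ []
pathColours 6 = 2 ∷ 1 ∷ 3 ∷ 1 ∷ 2 ∷ 1 ∷ 4 ∷ 1 ∷ 3 ∷ 1 ∷ 2 ∷ []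
pathColours 7 = 2 ∷ 1 ∷ 3 ∷ 1 ∷ 2 ∷ 1 ∷ 4 ∷ 1 ∷ 2 ∷ 3 ∷ 1 ∷ 2 ∷ []
pathColours (suc (suc (suc (suc n)))) = 2 ∷ 1 ∷ 3 ∷ 1 ∷ pathColours n

pathColours-4+ : ∀ n → ∃ λ rest → pathColours (4 + n) ≡ 2 ∷ 1 ∷ 3 ∷ 1 ∷ rest
pathColours-4+ 0 = _ , refl
pathColours-4+ 1 = _ , refl
pathColours-4+ 2 = _ , refl
pathColours-4+ 3 = _ , refl
pathColours-4+ (suc (suc (suc (suc n)))) = _ , refl

length-pathColours : ∀ n → length (pathColours n) ≡ 5 + n
length-pathColours 0 = refl
length-pathColours 1 = refl
length-pathColours 2 = refl
length-pathColours 3 = refl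
length-pathColours 4 = refl
length-pathColours 5 = refl
length-pathColours 6 = refl
length-pathColours 7 = refl
length-pathColours (suc (suc (suc (suc n@(suc (suc (suc (suc _)))))))) = cong (4 +_) (length-pathColours n)

Valid-pathColours : ∀ n → Valid (pathColours n)
Valid-pathColours 0 = _
Valid-pathColours 1 = _
Valid-pathColours 2 = _
Valid-pathColours 3 = _
Valid-pathColours 4 = _
Valid-pathColours 5 = _
Valid-pathColours 6 = _
Valid-pathColours 7 = _
Valid-pathColours (suc (suc (suc (suc n@(suc (suc (suc (suc m)))))))) with pathColours-4+ m | Valid-pathColours n
... | rest , eq | valid rewrite eq = Valid-prepend-2131 valid

pathColouring : ∀ n → PathColouring (4 + n) (at (pathColours n))
pathColouring n =
  subst (λ L → PathColouring L (at (pathColours n))) (cong pred (length-pathColours n))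
        (Valid⇒PathColouring (pathColours n) (Valid-pathColours n))

-- The subdivision S_i(G)

module _ {n : ℕ} (G : SimpleGraph n) where

  toEdge : ∀ {u v} → GAdj G u v → Edge G
  toEdge {u} {v} u~v with <-cmp (toℕ u) (toℕ v)
  ... | tri< u<v _ _ = edge u v u<v u~v
  ... | tri≈ _ u≡v _ = ⊥-elim (subst T (irrefl G v) (subst (λ w → GAdj G w v) (toℕ-injective u≡v) u~v))
  ... | tri> _ _ v<u = edge v u v<u (subst T (SimpleGraph.sym G u v) u~v)

  Edge-≡ : ∀ {e e′ : Edge G} → Edge.a e ≡ Edge.a e′ → Edge.b e ≡ Edge.b e′ → e ≡ e′
  Edge-≡ {edge a b lt ok} {edge _ _ lt′ ok′} refl refl =
    cong₂ (edge a b) (<-irrelevant lt lt′) (T-irrelevant ok ok′)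

  Edge-≟ : DecidableEquality (Edge G)
  Edge-≟ e e′ =
    map′ (uncurry Edge-≡) (λ { refl → refl , refl }) (Edge.a e ≟ᶠ Edge.a e′ ×-dec Edge.b e ≟ᶠ Edge.b e′)

  edgesBetween : Fin n → Fin n → List (Edge G)
  edgesBetween u v with toℕ u <? toℕ v ×-dec T? (adj G u v)
  ... | yes (u<v , u~v) = edge u v u<v u~v ∷ []
  ... | no _            = []

  ∈-edgesBetween : ∀ e → e ∈ edgesBetween (Edge.a e) (Edge.b e)
  ∈-edgesBetween (edge a b a<b a~b) with toℕ a <? toℕ b ×-dec T? (adj G a b)
  ... | yes _  = here (Edge-≡ refl refl)
  ... | no ¬e = ⊥-elim (¬e (a<b , a~b))

  edges : List (Edge G)
  edges = concatMap (λ u → concatMap (edgesBetween u) (allFin n)) (allFin n)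

  ∈-edges : ∀ e → e ∈ edges
  ∈-edges e =
    ∈-concatMap⁺ _ (lose (∈-allFin (Edge.a e)) (∈-concatMap⁺ _ (lose (∈-allFin (Edge.b e)) (∈-edgesBetween e))))

  module _ (i : ℕ) where

    vertices : List (SubV G i)
    vertices = map inj₁ (allFin n) ++ map inj₂ (cartesianProduct edges (allFin i))

    ∈-vertices : ∀ x → x ∈ vertices
    ∈-vertices (inj₁ u)       = ∈-++⁺ˡ (∈-map⁺ inj₁ (∈-allFin u))
    ∈-vertices (inj₂ (e , k)) = ∈-++⁺ʳ _ (∈-map⁺ inj₂ (∈-cartesianProduct⁺ (∈-edges e) (∈-allFin k)))

    SubV-≟ : DecidableEquality (SubV G i)
    SubV-≟ = Sum.≡-dec _≟ᶠ_ (Product.≡-dec Edge-≟ _≟ᶠ_)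

    subStep? : Decidable (SubStep G i)
    subStep? (inj₁ _) (inj₁ _) = no λ ()
    subStep? (inj₁ u) (inj₂ (e , k)) with u ≟ᶠ Edge.a e | toℕ k ≟ 0
    ... | yes refl | yes k≡0 = yes (start e k k≡0)
    ... | no u≢a   | _       = no λ { (start _ _ _) → u≢a refl }
    ... | yes _    | no k≢0  = no λ { (start _ _ k≡0) → k≢0 k≡0 }
    subStep? (inj₂ (e , k)) (inj₂ (e′ , k′)) with Edge-≟ e e′ | toℕ k′ ≟ suc (toℕ k)
    ... | yes refl | yes next = yes (mid e k k′ next)
    ... | no e≢e′  | _        = no λ { (mid _ _ _ _) → e≢e′ refl }
    ... | yes _    | no ¬next = no λ { (mid _ _ _ next) → ¬next next }
    subStep? (inj₂ (e , k)) (inj₁ v) with v ≟ᶠ Edge.b e | suc (toℕ k) ≟ i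
    ... | yes refl | yes last = yes (end e k last)
    ... | no v≢b   | _        = no λ { (end _ _ _) → v≢b refl }
    ... | yes _    | no ¬last = no λ { (end _ _ last) → ¬last last }

    subAdj? : Decidable (SubAdj G i)
    subAdj? x y = subStep? x y ⊎-dec subStep? y x

Connected⇒Edge : ∀ {n} (G : SimpleGraph n) → 2 ≤ n → Connected (GAdj G) → Edge G
Connected⇒Edge G (s≤s (s≤s _)) connected with connected zero (suc zero)
... | _ , step u~v _ = toEdge G u~v

¬PackingColouring₂-Sᵢ : ∀ {n} (G : SimpleGraph n) i → Edge G → ¬ PackingColouring (SubAdj G (3 + i)) 2
¬PackingColouring₂-Sᵢ G i e =
  ¬PackingColouring₂-P₄ (inj₁ (start e zero refl)) (inj₁ (mid e zero (suc zero) refl))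
                        (inj₁ (mid e (suc zero) (suc (suc zero)) refl)) (λ ()) (λ ()) (λ ()) (λ ()) (λ ())

module Distances {n : ℕ} (G : SimpleGraph n) (i : ℕ) where

  L : ℕ
  L = suc i

  pos : Fin i → ℕ
  pos k = suc (toℕ k)

  -- Lower bound for the distance from a to the vertex at position p (from 0 to L) of the path replacing e.
  distLBAlong : Fin n → Edge G → ℕ → ℕ
  distLBAlong a e p with Edge.a e ≟ᶠ a | Edge.b e ≟ᶠ a
  ... | yes _ | _     = p
  ... | no _  | yes _ = L ∸ p
  ... | no _  | no _  = L

  distLB : Fin n → SubV G i → ℕ
  distLB a (inj₁ u) with u ≟ᶠ a
  ... | yes _ = 0
  ... | no _  = L
  distLB a (inj₂ (e , k)) = distLBAlong a e (pos k)

  distLB-self : ∀ a → distLB a (inj₁ a) ≡ 0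
  distLB-self a with a ≟ᶠ a
  ... | yes _   = refl
  ... | no a≢a = ⊥-elim (a≢a refl)

  distLB-other : ∀ {a u} → u ≢ a → distLB a (inj₁ u) ≡ L
  distLB-other {a} {u} u≢a with u ≟ᶠ a
  ... | yes u≡a = ⊥-elim (u≢a u≡a)
  ... | no _    = refl

  distLB-start : ∀ a e → distLB a (inj₁ (Edge.a e)) ≡ distLBAlong a e 0
  distLB-start a e with Edge.a e ≟ᶠ a | Edge.b e ≟ᶠ a
  ... | yes _ | _     = refl
  ... | no _  | yes _ = refl
  ... | no _  | no _  = refl

  distLB-end : ∀ a e → distLB a (inj₁ (Edge.b e)) ≡ distLBAlong a e L
  distLB-end a e with Edge.a e ≟ᶠ a | Edge.b e ≟ᶠ a
  ... | yes a≡ | yes b≡ = ⊥-elim (<-irrefl (cong toℕ (trans a≡ (sym b≡))) (Edge.lt e))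
  ... | yes _  | no _   = refl
  ... | no _   | yes _  = sym (n∸n≡0 L)
  ... | no _   | no _   = refl

  distLBAlong-from-start : ∀ e p → distLBAlong (Edge.a e) e p ≡ p
  distLBAlong-from-start e p with Edge.a e ≟ᶠ Edge.a e
  ... | yes _   = refl
  ... | no a≢a = ⊥-elim (a≢a refl)

  distLBAlong-step : ∀ a e {p} → p < L → ∣ distLBAlong a e p - distLBAlong a e (suc p) ∣ ≤ 1
  distLBAlong-step a e {p} (s≤s p≤i) with Edge.a e ≟ᶠ a | Edge.b e ≟ᶠ a
  ... | yes _ | _     = ≤-reflexive (∣n-1+n∣≡1 p)
  ... | no _  | yes _ = ≤-reflexive (begin
    ∣ L ∸ p - i ∸ p ∣           ≡⟨ cong (∣_- i ∸ p ∣) (+-∸-assoc 1 p≤i) ⟩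
    ∣ suc (i ∸ p) - i ∸ p ∣     ≡⟨ ∣-∣-comm (suc (i ∸ p)) (i ∸ p) ⟩
    ∣ i ∸ p - suc (i ∸ p) ∣     ≡⟨ ∣n-1+n∣≡1 (i ∸ p) ⟩
    1                           ∎)
    where open ≡-Reasoning
  ... | no _  | no _  = subst (_≤ 1) (sym (∣n-n∣≡0 L)) z≤n

  distLB-step : ∀ a {x y} → SubStep G i x y → ∣ distLB a x - distLB a y ∣ ≤ 1
  distLB-step a (start e k k≡0) rewrite distLB-start a e | k≡0 = distLBAlong-step a e (s≤s z≤n)
  distLB-step a (mid e k k′ next) rewrite next = distLBAlong-step a e (s≤s (toℕ<n k))
  distLB-step a (end e k last) rewrite distLB-end a e =
    subst (λ q → ∣ distLBAlong a e (pos k) - distLBAlong a e q ∣ ≤ 1) (cong suc last)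
          (distLBAlong-step a e (s≤s (toℕ<n k)))

  distLB-Lipschitz : ∀ a → Lipschitz {Adj = SubAdj G i} (distLB a)
  distLB-Lipschitz a (inj₁ x→y) = distLB-step a x→y
  distLB-Lipschitz a {x} {y} (inj₂ y→x) = subst (_≤ 1) (∣-∣-comm (distLB a y) (distLB a x)) (distLB-step a y→x)

  distLB≤length : ∀ a {x y m} → Walk (SubAdj G i) x y m → ∣ distLB a x - distLB a y ∣ ≤ m
  distLB≤length a = Lipschitz⇒∣-∣≤length {φ = distLB a} (distLB-Lipschitz a)

  distLB-from : ∀ {a y m} → Walk (SubAdj G i) (inj₁ a) y m → distLB a y ≤ m
  distLB-from {a} {y} {m} w = subst (λ d → ∣ d - distLB a y ∣ ≤ m) (distLB-self a) (distLB≤length a w)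

  distLB-to : ∀ {a y m} → Walk (SubAdj G i) y (inj₁ a) m → distLB a y ≤ m
  distLB-to {a} {y} {m} w =
    subst (_≤ m) (∣-∣-identityʳ (distLB a y))
          (subst (λ d → ∣ distLB a y - d ∣ ≤ m) (distLB-self a) (distLB≤length a w))

  -- A walk leaving the interior of the path of e passes through one of its ends.
  escape : ∀ {e k v m} → Walk (SubAdj G i) (inj₂ (e , k)) v m → (∀ k′ → v ≢ inj₂ (e , k′)) →
           pos k + distLB (Edge.a e) v ≤ m ⊎ (L ∸ pos k) + distLB (Edge.b e) v ≤ m
  escape here outside = ⊥-elim (outside _ refl)
  escape {e} {k} {v} {suc m} (step (inj₁ (mid _ _ k′ next)) w) outside with escape w outside
  ... | inj₁ h = inj₁ (m≤n⇒m≤1+n (<⇒≤ (subst (λ t → suc t + distLB (Edge.a e) v ≤ m) next h)))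
  ... | inj₂ h = inj₂ (subst (λ t → t + distLB (Edge.b e) v ≤ suc m) (sym one-more) (s≤s h))
    where
    one-more : i ∸ toℕ k ≡ suc (i ∸ toℕ k′)
    one-more = trans (n<m⇒m∸n≡1+[m∸[1+n]] (subst (_≤ i) next (<⇒≤ (toℕ<n k′))))
                     (cong (λ t → suc (i ∸ t)) (sym next))
  escape {e} {k} {v} {suc m} (step (inj₁ (end _ _ last)) w) _ =
    inj₂ (subst (λ t → t + distLB (Edge.b e) v ≤ suc m) (sym last-step) (s≤s (distLB-from w)))
    where
    last-step : i ∸ toℕ k ≡ 1
    last-step = trans (cong (_∸ toℕ k) (sym last)) (m+n∸n≡m 1 (toℕ k))
  escape {e} {k} {v} {suc m} (step (inj₂ (start _ _ k≡0)) w) _ =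
    inj₁ (subst (λ t → suc t + distLB (Edge.a e) v ≤ suc m) (sym k≡0) (s≤s (distLB-from w)))
  escape {e} {k} {v} {suc m} (step (inj₂ (mid _ k₀ _ next)) w) outside with escape w outside
  ... | inj₁ h = inj₁ (subst (λ t → suc t + distLB (Edge.a e) v ≤ suc m) (sym next) (s≤s h))
  ... | inj₂ h =
    inj₂ (m≤n⇒m≤1+n (≤-trans (+-monoˡ-≤ _ (∸-monoʳ-≤ i (subst (toℕ k₀ ≤_) (sym next) (n≤1+n _)))) h))

module SubdivisionColouring {n : ℕ} (G : SimpleGraph n) (i : ℕ) {c : ℕ → ℕ} (pc : PathColouring (suc i) c) where

  open PathColouring pc hiding (colour-range)
  open Distances G i

  colour : SubV G i → ℕ
  colour (inj₁ _)       = c 0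
  colour (inj₂ (_ , k)) = c (pos k)

  0<pos : ∀ k → 0 < pos k
  0<pos _ = s≤s z≤n

  pos<L : ∀ k → pos k < L
  pos<L k = s≤s (toℕ<n k)

  c₀<L : c 0 < L
  c₀<L = packing (s≤s z≤n) ≤-refl (sym ends-agree)

  c₀<distLBAlong : ∀ a e {p} → 0 < p → p < L → c 0 ≡ c p → c 0 < distLBAlong a e p
  c₀<distLBAlong a e {p} 0<p p<L c₀≡cp with Edge.a e ≟ᶠ a | Edge.b e ≟ᶠ a
  ... | yes _ | _     = packing 0<p (<⇒≤ p<L) c₀≡cp
  ... | no _  | yes _ = subst (_< L ∸ p) (sym c₀≡cp) (packing p<L ≤-refl (trans (sym c₀≡cp) (sym ends-agree)))
  ... | no _  | no _  = c₀<L

  ⌊c/2⌋<distLBAlong : ∀ a e {p} → 0 < p → p < L → ⌊ c p /2⌋ < distLBAlong a e p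
  ⌊c/2⌋<distLBAlong a e 0<p p<L with Edge.a e ≟ᶠ a | Edge.b e ≟ᶠ a
  ... | yes _ | _     = far-from-start 0<p p<L
  ... | no _  | yes _ = far-from-end 0<p p<L
  ... | no _  | no _  = <-trans (far-from-start 0<p p<L) p<L

  colour-range : ∀ x → 1 ≤ colour x × colour x ≤ 4
  colour-range (inj₁ _)       = PathColouring.colour-range pc z≤n
  colour-range (inj₂ (_ , k)) = PathColouring.colour-range pc (<⇒≤ (pos<L k))

  isPacking : ∀ x y → x ≢ y → colour x ≡ colour y → DistGreater (SubAdj G i) x y (colour x)
  isPacking (inj₁ u) (inj₁ u′) u≢u′ _ m w =
    <-≤-trans c₀<L (subst (_≤ m) (distLB-other (λ u′≡u → u≢u′ (cong inj₁ (sym u′≡u)))) (distLB-from w))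
  isPacking (inj₁ u) (inj₂ (e , k)) _ c₀≡ m w =
    <-≤-trans (c₀<distLBAlong u e (0<pos k) (pos<L k) c₀≡) (distLB-from w)
  isPacking (inj₂ (e , k)) (inj₁ u) _ ≡c₀ m w =
    subst (_< m) (sym ≡c₀) (<-≤-trans (c₀<distLBAlong u e (0<pos k) (pos<L k) (sym ≡c₀)) (distLB-to w))
  isPacking (inj₂ (e , k)) (inj₂ (e′ , k′)) x≢y same m w with Edge-≟ G e e′
  ... | yes refl =
    <-≤-trans (packing-∣-∣ pos≢pos′ (<⇒≤ (pos<L k)) (<⇒≤ (pos<L k′)) same)
              (subst₂ (λ p q → ∣ p - q ∣ ≤ m)
                      (distLBAlong-from-start e (pos k)) (distLBAlong-from-start e (pos k′))
                      (distLB≤length (Edge.a e) w))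
    where
    pos≢pos′ : pos k ≢ pos k′
    pos≢pos′ eq = x≢y (cong (λ k → inj₂ (e , k)) (toℕ-injective (suc-injective eq)))
  ... | no e≢e′ = [ via-start , via-end ]′ (escape w λ { _ refl → e≢e′ refl })
    where
    ⌊c/2⌋<distLB : ∀ a → ⌊ c (pos k) /2⌋ < distLB a (inj₂ (e′ , k′))
    ⌊c/2⌋<distLB a = subst (λ t → ⌊ t /2⌋ < _) (sym same) (⌊c/2⌋<distLBAlong a e′ (0<pos k′) (pos<L k′))
    via-start : pos k + distLB (Edge.a e) (inj₂ (e′ , k′)) ≤ m → c (pos k) < m
    via-start =
      <-≤-trans (⌊n/2⌋<m⇒⌊n/2⌋<o⇒n<m+o (far-from-start (0<pos k) (pos<L k)) (⌊c/2⌋<distLB (Edge.a e)))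
    via-end : (L ∸ pos k) + distLB (Edge.b e) (inj₂ (e′ , k′)) ≤ m → c (pos k) < m
    via-end =
      <-≤-trans (⌊n/2⌋<m⇒⌊n/2⌋<o⇒n<m+o (far-from-end (0<pos k) (pos<L k)) (⌊c/2⌋<distLB (Edge.b e)))

  packingColouring : PackingColouring (SubAdj G i) 4
  packingColouring = colour , colour-range , isPacking

mainTheorem11 : ∀ (n : ℕ) (G : SimpleGraph n) (i : ℕ) →
    3 ≤ n → Connected (GAdj G) → 3 ≤ i →
    ∃ λ k → IsPackingChromaticNumber (SubAdj G i) k × 3 ≤ k × k ≤ 4
mainTheorem11 n G (suc (suc (suc i))) 3≤n connected (s≤s (s≤s (s≤s _))) =
  packingChromaticNumber-squeeze
    (¬PackingColouring₂-Sᵢ G i (Connected⇒Edge G (≤-trans (n≤1+n 2) 3≤n) connected))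
    (SubdivisionColouring.packingColouring G (3 + i) (pathColouring i))
    (packingColouring? 3)
  where
  open FiniteGraph (vertices G (3 + i)) (∈-vertices G (3 + i)) (SubV-≟ G (3 + i)) (subAdj? G (3 + i))
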